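{- Let $n\ge1$. The map $\overline{\rho}:\mathrm{NC}^{\mathrm{NA}}(n)\to\mathrm{NN}^{\mathrm{NA}}(n)$ is a bijection such that if $\overline\rho(\sigma,X)=(\sigma',X')$ and $X=\{A_1,\dots,A_k\}_<$, then $\operatorname{type}(\sigma)=\operatorname{type}(\sigma')$ and $X'=\{A'_1,\dots,A'_k\}_<$ with $\max(A_i)=\max(A'_i)$ and $|A_i|=|A'_i|$ for all $i\in[k]$.
   Context: $[n]=\{1,\dots,n\}$, $\Pi(n)$ = set partitions of $[n]$. An edge of $\sigma\in\Pi(n)$ is a pair $(i,j)$, $i<j$, in the same block with no element of that block strictly between. $\mathrm{NC}(n)$: no two edges $(a,b),(c,d)$ with $a<c<b<d$; $\mathrm{NN}(n)$: no two edges with $a<c<d<b$. A block $B$ of $\sigma$ is nonaligned if there is no edge $(i,j)$ of $\sigma$ with $\max B<i$. $\mathrm{NC}^{\mathrm{NA}}(n)=\{(\sigma,X):\sigma\in\mathrm{NC}(n),\ X\text{ a set of nonaligned blocks of }\sigma\}$ and $\mathrm{NN}^{\mathrm{NA}}(n)$ is defined likewise with $\mathrm{NN}(n)$. The type of a partition is the multiset of its block sizes. $\{A_1,\dots,A_k\}_<$ means $\max A_1<\cdots<\max A_k$. It is known (Athanasiadis) that for $\sigma\in\mathrm{NC}(n)$ with blocks $\{A_1,\dots,A_k\}_<$ there is a unique $\rho(\sigma)\in\mathrm{NN}(n)$ with blocks $\{A'_1,\dots,A'_k\}_<$ satisfying $\max A'_i=\max A_i$ and $|A'_i|=|A_i|$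 for all $i$. For $(\sigma,X)\in\mathrm{NC}^{\mathrm{NA}}(n)$ with $\sigma$ having blocks $\{A_1,\dots,A_k\}_<$ and $X=\{A_{i_1},\dots,A_{i_r}\}$, and $\rho(\sigma)$ having blocks $\{A'_1,\dots,A'_k\}_<$, define $\overline\rho(\sigma,X)=(\rho(\sigma),\{A'_{i_1},\dots,A'_{i_r}\})$. -}

module Defs where

open import Data.Nat using (ℕ)
open import Data.Fin using (Fin; _<_)
open import Data.Bool using (Bool; true)
open import Data.List using (List; []; _∷_; length; lookup; map)
open import Data.List.NonEmpty as List⁺ using (List⁺; toList)
open import Data.List.Membership.Propositional using (_∈_; _∉_)
open import Data.List.Relation.Unary.Any using (Any)
open import Data.List.Relation.Unary.All using (All)
open import Data.List.Relation.Unary.AllPairs using (AllPairs)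
open import Data.List.Relation.Unary.Linked using (Linked)
open import Data.List.Relation.Binary.Pointwise using (Pointwise)
open import Data.Vec as Vec using (Vec)
open import Data.Product using (_×_; Σ-syntax)
open import Relation.Nullary using (¬_)
open import Relation.Binary.PropositionalEquality using (_≡_)

-- [n] is modelled by Fin n (element i ↦ i+1).
-- A block is a nonempty list of elements, listed in strictly increasing order.
Block : ℕ → Set
Block n = List⁺ (Fin n)

maxB : ∀ {n} → Block n → Fin n
maxB = List⁺.last

sizeB : ∀ {n} → Block n → ℕ
sizeB = List⁺.length

-- A set partition of [n], represented canonically as the list of its blocks
-- {A_1,…,A_k}_< (ordered by increasing maxima), each block listed increasingly.
record IsSetPartition (n : ℕ) (bs : List (Block n)) : Set where
  field
    increasing : All (λ B → Linked _<_ (toList B)) bs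
    ordered    : Linked (λ A B → maxB A < maxB B) bs
    disjoint   : AllPairs (λ A B → ∀ i → i ∈ toList A → i ∉ toList B) bs
    covering   : ∀ (i : Fin n) → Any (λ B → i ∈ toList B) bs

record SetPartition (n : ℕ) : Set where
  constructor mkPartition
  field
    blocks : List (Block n)
    .isPartition : IsSetPartition n blocks
open SetPartition public

Edge : ∀ {n} → SetPartition n → Fin n → Fin n → Set
Edge σ i j = i < j × Any (λ B → i ∈ toList B × j ∈ toList B ×
                         (∀ m → m ∈ toList B → ¬ (i < m × m < j))) (blocks σ)

NonCrossing : ∀ {n} → SetPartition n → Set
NonCrossing σ = ∀ a b c d → Edge σ a b → Edge σ c d → ¬ (a < c × c < b × b < d)

NonNesting : ∀ {n} → SetPartition n → Set
NonNesting σ = ∀ a b c d → Edge σ a b → Edge σ c d → ¬ (a < c × c < d × d < b)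

Nonaligned : ∀ {n} → SetPartition n → Block n → Set
Nonaligned σ B = ∀ i j → Edge σ i j → ¬ (maxB B < i)

record NC (n : ℕ) : Set where
  constructor mkNC
  field
    part : SetPartition n
    .nc  : NonCrossing part

record NN (n : ℕ) : Set where
  constructor mkNN
  field
    part : SetPartition n
    .nn  : NonNesting part

-- (σ , X): X is encoded by marks, marks[p] = true iff the p-th block A_{p+1} ∈ X
record NCNA (n : ℕ) : Set where
  constructor mkNCNA
  field
    part  : SetPartition n
    .nc   : NonCrossing part
    marks : Vec Bool (length (blocks part))
    .na   : ∀ p → Vec.lookup marks p ≡ true → Nonaligned part (lookup (blocks part) p)

record NNNA (n : ℕ) : Set where
  constructor mkNNNA
  field
    part  : SetPartition n
    .nn   : NonNesting part
    marks : Vec Bool (length (blocks part))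
    .na   : ∀ p → Vec.lookup marks p ≡ true → Nonaligned part (lookup (blocks part) p)

ncOf : ∀ {n} → NCNA n → NC n
ncOf (mkNCNA p c _ _) = mkNC p c

selectMarked : ∀ {n} → (bs : List (Block n)) → Vec Bool (length bs) → List (Block n)
selectMarked []       _                   = []
selectMarked (B ∷ bs) (Vec._∷_ true  ms) = B ∷ selectMarked bs ms
selectMarked (B ∷ bs) (Vec._∷_ _     ms) = selectMarked bs ms

XofNC : ∀ {n} → NCNA n → List (Block n)
XofNC x = selectMarked (blocks (NCNA.part x)) (NCNA.marks x)

XofNN : ∀ {n} → NNNA n → List (Block n)
XofNN y = selectMarked (blocks (NNNA.part y)) (NNNA.marks y)

SameMaxSize : ∀ {n} → Block n → Block n → Set
SameMaxSize A A' = maxB A ≡ maxB A' × sizeB A ≡ sizeB A'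

Matches : ∀ {n} → List (Block n) → List (Block n) → Set
Matches = Pointwise SameMaxSize

-- type of a partition: the multiset of block sizes (as a list, compared up to permutation)
type : ∀ {n} → SetPartition n → List ℕ
type σ = map sizeB (blocks σ)

module Submission where

open import Defs
open import Data.Nat using (ℕ; _≤_)
open import Data.Product using (Σ-syntax; _×_)
open import Data.Vec using (toList)
open import Data.List.Relation.Binary.Permutation.Propositional using (_↭_)
open import Function.Definitions using (Bijective)
open import Function.Definitions using (Injective; Surjective)
open import Relation.Binary.PropositionalEquality using (_≡_)

open import Data.Nat as ℕ using (suc; s≤s; z≤n; _∸_; _+_)
import Data.Nat.Properties as ℕP
open import Data.Fin as Fin using (Fin) renaming (_<_ to _<ᶠ_; _≤_ to _≤ᶠ_)
import Data.Fin.Properties as FP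
open import Data.Fin.Induction using (>-wellFounded)
open import Induction.WellFounded using (Acc; acc)
open import Data.Bool using (Bool; true; false)
open import Data.List as L using (List; []; _∷_; _++_; length; filter; take; drop; map; allFin)
import Data.List.Properties as LP
open import Data.List.NonEmpty as L⁺ using (_∷_) renaming (toList to tl)
open import Data.List.Membership.Propositional using (_∈_; _∉_; find; lose)
open import Data.List.Membership.Propositional.Properties
  using (∈-++⁺ˡ; ∈-++⁺ʳ; ∈-++⁻; ∈-filter⁺; ∈-filter⁻; ∈-allFin)
open import Data.List.Relation.Unary.Any as Any using (Any; here; there)
open import Data.List.Relation.Unary.All as All using (All; []; _∷_)
import Data.List.Relation.Unary.All.Properties as AllP
open import Data.List.Relation.Unary.AllPairs using (AllPairs; []; _∷_)
import Data.List.Relation.Unary.AllPairs as AllPairs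
import Data.List.Relation.Unary.AllPairs.Properties as APP
import Data.List.Relation.Unary.Linked.Properties as LinkedP
open import Data.List.Relation.Binary.Pointwise using (Pointwise; []; _∷_; Pointwise-≡⇒≡)
import Data.List.Relation.Binary.Pointwise as Pointwise
import Data.List.Relation.Binary.Pointwise.Properties as PWP
open import Data.List.Relation.Binary.Permutation.Propositional using (↭-reflexive)
open import Data.Vec as V using (Vec; []; _∷_)
import Data.Vec.Properties as VP
open import Data.Product using (Σ; ∃; _,_; proj₁; proj₂)
open import Data.Sum using (_⊎_; inj₁; inj₂; [_,_]′)
open import Data.Empty using (⊥; ⊥-elim)
open import Relation.Nullary using (¬_; Dec; yes; no)
open import Relation.Nullary.Decidable using (recompute; map′; _×-dec_)
open import Relation.Unary using (Decidable)
open import Relation.Binary using (tri<; tri≈; tri>; DecidableEquality)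
open import Relation.Binary.PropositionalEquality
  using (_≢_; refl; sym; trans; cong; cong₂; subst; module ≡-Reasoning)

-- The profile of a partition is the list of pairs (max A_i , |A_i|); Matches xs ys says that
-- xs and ys have the same profile.  The hypothesis on ρ says that ρ(σ) has the profile of σ,
-- and ρ̄ keeps the marks on the blocks of equal index.  The proof rests on two facts:
--   * Uniqueness: two noncrossing, or two nonnesting, partitions with the same profile are
--     equal.  Going down from n, every element lies in blocks with the same maximum in both;
--     a first disagreement at t yields edges leaving t in both partitions and edges jumping
--     over t in both, which form a crossing in one partition and a nesting in the other.
--   * Existence: every profile of a partition is that of a noncrossing partition, built
--     greedily by giving the block with maximum m the largest unused elements below m.
-- So ρ̄ is injective by uniqueness for NC and surjective by existence and uniqueness for NN.
-- Nonalignment of a block depends only on which elements are block maxima, hence marks stay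
-- valid; type and the matching of marked blocks follow from the equality of profiles.

module _ {A : Set} where
  _⊆_ : List A → List A → Set
  xs ⊆ ys = ∀ {z} → z ∈ xs → z ∈ ys

  Distinct : List A → Set
  Distinct = AllPairs _≢_

  extremum : {R : A → A → Set} → (∀ x y → R x y ⊎ R y x) → (∀ {x y z} → R x y → R y z → R x z)
    → {P : A → Set} → Decidable P → (xs : List A) → Any P xs
    → Σ A λ a → a ∈ xs × P a × (∀ z → z ∈ xs → P z → R a z)
  extremum tot tr P? (y ∷ ys) anyP with Any.any? P? ys | anyP
  ... | no none | there q = ⊥-elim (none q)
  ... | no none | here py = y , here refl , py , λ
    { z (here refl) _ → [ (λ r → r) , (λ r → r) ]′ (tot y y)
    ; z (there z∈) pz → ⊥-elim (none (lose z∈ pz)) }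
  ... | yes q | _ with extremum tot tr P? ys q | P? y
  ... | a , a∈ , pa , best | no ¬py = a , there a∈ , pa , λ
    { z (here refl) pz → ⊥-elim (¬py pz)
    ; z (there z∈) pz → best z z∈ pz }
  ... | a , a∈ , pa , best | yes py with tot y a
  ... | inj₁ ya = y , here refl , py , λ
    { z (here refl) _ → [ (λ r → r) , (λ r → r) ]′ (tot y y)
    ; z (there z∈) pz → tr ya (best z z∈ pz) }
  ... | inj₂ ay = a , there a∈ , pa , λ
    { z (here refl) _ → ay
    ; z (there z∈) pz → best z z∈ pz }

module _ {A : Set} (_≟_ : DecidableEquality A) where
  remove : A → List A → List A
  remove x [] = []
  remove x (y ∷ ys) with x ≟ y
  ... | yes _ = ys
  ... | no _ = y ∷ remove x ys

  length-remove : ∀ {x} ys → x ∈ ys → suc (length (remove x ys)) ≡ length ys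
  length-remove {x} (y ∷ ys) p with x ≟ y
  ... | yes _ = refl
  length-remove {x} (y ∷ ys) (here x≡y) | no x≢y = ⊥-elim (x≢y x≡y)
  length-remove {x} (y ∷ ys) (there p) | no _ = cong suc (length-remove ys p)

  ∈-remove : ∀ {x z} ys → z ∈ ys → z ≢ x → z ∈ remove x ys
  ∈-remove {x} (y ∷ ys) p z≢x with x ≟ y | p
  ... | yes refl | here refl = ⊥-elim (z≢x refl)
  ... | yes _ | there q = q
  ... | no _ | here q = here q
  ... | no _ | there q = there (∈-remove ys q z≢x)

  distinct-⊆⇒length-≤ : ∀ {xs ys : List A} → Distinct xs → xs ⊆ ys → length xs ℕ.≤ length ys
  distinct-⊆⇒length-≤ {[]} _ _ = z≤n
  distinct-⊆⇒length-≤ {x ∷ xs} {ys} (x∉xs ∷ dxs) xs⊆ys =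
    subst (length (x ∷ xs) ℕ.≤_) (length-remove ys (xs⊆ys (here refl)))
      (s≤s (distinct-⊆⇒length-≤ dxs λ z∈ →
        ∈-remove ys (xs⊆ys (there z∈)) (λ z≡x → All.lookup x∉xs z∈ (sym z≡x))))

  distinct-⊊⇒length-< : ∀ {xs ys : List A} {x} → Distinct xs → xs ⊆ ys → x ∈ ys → x ∉ xs
    → length xs ℕ.< length ys
  distinct-⊊⇒length-< {xs} dxs xs⊆ys x∈ys x∉xs =
    distinct-⊆⇒length-≤ {_ ∷ xs}
      (All.tabulate (λ y∈ x≡y → x∉xs (subst (_∈ xs) (sym x≡y) y∈)) ∷ dxs)
      (λ { (here refl) → x∈ys ; (there p) → xs⊆ys p })

module _ {n : ℕ} where
  Sorted : List (Fin n) → Set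
  Sorted = AllPairs _<ᶠ_

  sorted⇒distinct : ∀ {xs} → Sorted xs → Distinct xs
  sorted⇒distinct = AllPairs.map FP.<⇒≢

  sorted-head≤ : ∀ {x xs z} → Sorted (x ∷ xs) → z ∈ x ∷ xs → x ≤ᶠ z
  sorted-head≤ _ (here refl) = ℕP.≤-refl
  sorted-head≤ (x< ∷ _) (there p) = ℕP.<⇒≤ (All.lookup x< p)

  sorted-≡ : ∀ {xs ys} → Sorted xs → Sorted ys → xs ⊆ ys → ys ⊆ xs → xs ≡ ys
  sorted-≡ {[]} {[]} _ _ _ _ = refl
  sorted-≡ {[]} {y ∷ ys} _ _ _ ys⊆ with ys⊆ (here refl)
  ... | ()
  sorted-≡ {x ∷ xs} {[]} _ _ xs⊆ _ with xs⊆ (here refl)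
  ... | ()
  sorted-≡ {x ∷ xs} {y ∷ ys} sx@(x< ∷ sxs) sy@(y< ∷ sys) xs⊆ ys⊆ =
    cong₂ _∷_ x≡y (sorted-≡ sxs sys tail⊆ tail⊇)
    where
    x≡y : x ≡ y
    x≡y = FP.≤-antisym (sorted-head≤ sx (ys⊆ (here refl))) (sorted-head≤ sy (xs⊆ (here refl)))
    tail⊆ : xs ⊆ ys
    tail⊆ z∈ with xs⊆ (there z∈)
    ... | here refl = ⊥-elim (FP.<-irrefl x≡y (All.lookup x< z∈))
    ... | there q = q
    tail⊇ : ys ⊆ xs
    tail⊇ z∈ with ys⊆ (there z∈)
    ... | here refl = ⊥-elim (FP.<-irrefl (sym x≡y) (All.lookup y< z∈))
    ... | there q = q

  sorted-++ : ∀ {xs ys : List (Fin n)} {p q} → Sorted (xs ++ ys) → p ∈ xs → q ∈ ys → p <ᶠ q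
  sorted-++ {x ∷ xs} (x< ∷ _) (here refl) q∈ = All.lookup x< (∈-++⁺ʳ xs q∈)
  sorted-++ {x ∷ xs} (_ ∷ s) (there p∈) q∈ = sorted-++ s p∈ q∈

  record LeastAbove (xs : List (Fin n)) (t : Fin n) : Set where
    field
      elem  : Fin n
      elem∈ : elem ∈ xs
      above : t <ᶠ elem
      least : ∀ z → z ∈ xs → t <ᶠ z → elem ≤ᶠ z

  record GreatestBelow (xs : List (Fin n)) (t : Fin n) : Set where
    field
      elem     : Fin n
      elem∈    : elem ∈ xs
      below    : elem <ᶠ t
      greatest : ∀ z → z ∈ xs → z <ᶠ t → z ≤ᶠ elem

  findLeastAbove : ∀ {xs t x} → x ∈ xs → t <ᶠ x → LeastAbove xs t
  findLeastAbove {xs} {t} x∈ t<x with extremum FP.≤-total FP.≤-trans (t Fin.<?_) xs (lose x∈ t<x)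
  ... | a , a∈ , t<a , least = record { elem = a ; elem∈ = a∈ ; above = t<a ; least = least }

  findGreatestBelow : ∀ {xs t x} → x ∈ xs → x <ᶠ t → GreatestBelow xs t
  findGreatestBelow {xs} {t} x∈ x<t
    with extremum (λ a b → FP.≤-total b a) (λ p q → FP.≤-trans q p) (Fin._<? t) xs (lose x∈ x<t)
  ... | c , c∈ , c<t , greatest = record { elem = c ; elem∈ = c∈ ; below = c<t ; greatest = greatest }

module _ {n : ℕ} where
  block-init : (B : Block n) → ∃ λ ys → tl B ≡ ys ++ L.[ maxB B ]
  block-init (x ∷ xs) with L.initLast xs
  ... | [] = [] , refl
  ... | ys L.∷ʳ′ y = x ∷ ys , refl

  max∈ : (B : Block n) → maxB B ∈ tl B
  max∈ B with block-init B
  ... | ys , eq = subst (maxB B ∈_) (sym eq) (∈-++⁺ʳ ys (here refl))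

  ≤max : (B : Block n) → Sorted (tl B) → ∀ {z} → z ∈ tl B → z ≤ᶠ maxB B
  ≤max B sB {z} z∈ with block-init B
  ... | ys , eq with ∈-++⁻ ys (subst (z ∈_) eq z∈)
  ... | inj₁ p = ℕP.<⇒≤ (sorted-++ (subst Sorted eq sB) p (here refl))
  ... | inj₂ (here refl) = ℕP.≤-refl

  size≡length : (B : Block n) → sizeB B ≡ length (tl B)
  size≡length (_ ∷ _) = refl

  tl-injective : ∀ {A B : Block n} → tl A ≡ tl B → A ≡ B
  tl-injective {_ ∷ _} {_ ∷ _} refl = refl

  Disjoint : Block n → Block n → Set
  Disjoint A B = ∀ i → i ∈ tl A → i ∉ tl B

  block-sorted : ∀ {bs B} → IsSetPartition n bs → B ∈ bs → Sorted (tl B)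
  block-sorted P b = LinkedP.Linked⇒AllPairs FP.<-trans (All.lookup (IsSetPartition.increasing P) b)

  block-unique : ∀ {bs B C i} → AllPairs Disjoint bs → B ∈ bs → C ∈ bs → i ∈ tl B → i ∈ tl C → B ≡ C
  block-unique _ (here refl) (here refl) _ _ = refl
  block-unique (B# ∷ _) (here refl) (there c) iB iC = ⊥-elim (All.lookup B# c _ iB iC)
  block-unique (C# ∷ _) (there b) (here refl) iB iC = ⊥-elim (All.lookup C# b _ iC iB)
  block-unique (_ ∷ d) (there b) (there c) iB iC = block-unique d b c iB iC

  max-injective : ∀ {bs B C} → AllPairs Disjoint bs → B ∈ bs → C ∈ bs → maxB B ≡ maxB C → B ≡ C
  max-injective {C = C} d b c eq = block-unique d b c (max∈ _) (subst (_∈ tl C) (sym eq) (max∈ C))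

  record InBlock (bs : List (Block n)) (y m : Fin n) : Set where
    constructor inBlock
    field
      block  : Block n
      block∈ : block ∈ bs
      member : y ∈ tl block
      max≡   : maxB block ≡ m

  IsMax : List (Block n) → Fin n → Set
  IsMax bs t = Σ (Block n) λ B → B ∈ bs × maxB B ≡ t

  inBlock-functional : ∀ {bs y k k'} → AllPairs Disjoint bs → InBlock bs y k → InBlock bs y k' → k ≡ k'
  inBlock-functional d (inBlock B b yB refl) (inBlock C c yC refl) = cong maxB (block-unique d b c yB yC)

  inBlock⇒∈ : ∀ {bs B y m} → AllPairs Disjoint bs → B ∈ bs → maxB B ≡ m → InBlock bs y m → y ∈ tl B
  inBlock⇒∈ d b refl (inBlock C c yC C≡) = subst (λ X → _ ∈ tl X) (max-injective d c b C≡) yC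

module _ {n : ℕ} where
  sameMaxSize-sym : ∀ {A B : Block n} → SameMaxSize A B → SameMaxSize B A
  sameMaxSize-sym (m , s) = sym m , sym s

  sameMaxSize-trans : ∀ {A B C : Block n} → SameMaxSize A B → SameMaxSize B C → SameMaxSize A C
  sameMaxSize-trans (m , s) (m' , s') = trans m m' , trans s s'

  matches-sym : ∀ {xs ys : List (Block n)} → Matches xs ys → Matches ys xs
  matches-sym = PWP.symmetric (λ {A} {B} → sameMaxSize-sym {A} {B})

  matches-trans : ∀ {xs ys zs : List (Block n)} → Matches xs ys → Matches ys zs → Matches xs zs
  matches-trans = PWP.transitive (λ {A} {B} {C} → sameMaxSize-trans {A} {B} {C})

  matching-block : ∀ {xs ys : List (Block n)} {B} → Matches xs ys → B ∈ xs → Σ (Block n) λ C → C ∈ ys × SameMaxSize B C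
  matching-block (r ∷ _) (here refl) = _ , here refl , r
  matching-block (_ ∷ pw) (there b) with matching-block pw b
  ... | C , c , r = C , there c , r

  isMax-transfer : ∀ {xs ys : List (Block n)} {t} → Matches xs ys → IsMax xs t → IsMax ys t
  isMax-transfer pw (B , b , max≡t) with matching-block pw b
  ... | C , c , (eq , _) = C , c , trans (sym eq) max≡t

  size-transfer : ∀ {xs ys : List (Block n)} {B C} → AllPairs Disjoint ys → Matches xs ys → B ∈ xs → C ∈ ys
    → maxB B ≡ maxB C → length (tl B) ≡ length (tl C)
  size-transfer {B = B} {C} d pw b c eq with matching-block pw b
  ... | C' , c' , (eq' , size) with max-injective d c' c (trans (sym eq') eq)
  ... | refl = trans (sym (size≡length B)) (trans size (size≡length C))

-- Uniqueness: a noncrossing or nonnesting partition is determined by its profile.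

module _ {n : ℕ} where
  -- edges, noncrossing and nonnesting for a block list (Edge σ is EdgeIn (blocks σ))
  EdgeIn : List (Block n) → Fin n → Fin n → Set
  EdgeIn bs i j = i <ᶠ j × Any (λ B → i ∈ tl B × j ∈ tl B ×
                         (∀ m → m ∈ tl B → ¬ (i <ᶠ m × m <ᶠ j))) bs

  NoncrossingIn : List (Block n) → Set
  NoncrossingIn bs = ∀ a b c d → EdgeIn bs a b → EdgeIn bs c d → ¬ (a <ᶠ c × c <ᶠ b × b <ᶠ d)

  NonnestingIn : List (Block n) → Set
  NonnestingIn bs = ∀ a b c d → EdgeIn bs a b → EdgeIn bs c d → ¬ (a <ᶠ c × c <ᶠ d × d <ᶠ b)

  SameKind : List (Block n) → List (Block n) → Set
  SameKind xs ys = (NoncrossingIn xs × NoncrossingIn ys) ⊎ (NonnestingIn xs × NonnestingIn ys)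

  sameKind-sym : ∀ {xs ys} → SameKind xs ys → SameKind ys xs
  sameKind-sym (inj₁ (x , y)) = inj₁ (y , x)
  sameKind-sym (inj₂ (x , y)) = inj₂ (y , x)

  edgeAcross : ∀ {bs B i j} → B ∈ bs → i ∈ tl B → j ∈ tl B → i <ᶠ j
    → (∀ z → z ∈ tl B → ¬ (i <ᶠ z × z <ᶠ j)) → EdgeIn bs i j
  edgeAcross b i∈ j∈ i<j gap = i<j , lose b (i∈ , j∈ , gap)

  edgeToNext : ∀ {bs B t} → B ∈ bs → t ∈ tl B → (s : LeastAbove (tl B) t)
    → EdgeIn bs t (LeastAbove.elem s)
  edgeToNext b t∈ s = edgeAcross b t∈ elem∈ above
    λ z z∈ (t<z , z<s) → ℕP.≤⇒≯ (least z z∈ t<z) z<s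
    where open LeastAbove s

  edgeOver : ∀ {bs B t} → B ∈ bs → t ∉ tl B → (p : GreatestBelow (tl B) t) (s : LeastAbove (tl B) t)
    → EdgeIn bs (GreatestBelow.elem p) (LeastAbove.elem s)
  edgeOver {t = t} b t∉ p s =
    edgeAcross b (GreatestBelow.elem∈ p) (LeastAbove.elem∈ s)
      (FP.<-trans (GreatestBelow.below p) (LeastAbove.above s)) gap
    where
    gap : ∀ z → z ∈ _ → ¬ (GreatestBelow.elem p <ᶠ z × z <ᶠ LeastAbove.elem s)
    gap z z∈ (p<z , z<s) with FP.<-cmp z t
    ... | tri< z<t _ _ = ℕP.≤⇒≯ (GreatestBelow.greatest p z z∈ z<t) p<z
    ... | tri≈ _ refl _ = t∉ z∈
    ... | tri> _ _ t<z = ℕP.≤⇒≯ (LeastAbove.least s z z∈ t<z) z<s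

  AgreeAt : List (Block n) → List (Block n) → Fin n → Set
  AgreeAt xs ys z = ∀ k → InBlock xs z k → InBlock ys z k

  AgreeAbove : List (Block n) → List (Block n) → Fin n → Set
  AgreeAbove xs ys t = ∀ z → t <ᶠ z → AgreeAt xs ys z

  -- The configuration produced by a disagreement at t: t lies in the block of xs with
  -- maximum m, joined by an edge of xs to its successor a, and in ys an edge jumps from
  -- below t to a.
  record Disagreement (xs ys : List (Block n)) (t m : Fin n) : Set where
    field
      next     : Fin n
      start    : Fin n
      t<next   : t <ᶠ next
      start<t  : start <ᶠ t
      next-in  : InBlock xs next m
      edge-x   : EdgeIn xs t next
      edge-y   : EdgeIn ys start next

  module Disagreeing (xs ys : List (Block n)) (Px : IsSetPartition n xs) (Py : IsSetPartition n ys)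
                     (same : Matches xs ys) (t : Fin n)
                     (up : AgreeAbove xs ys t) (down : AgreeAbove ys xs t) where
    private
      dx = IsSetPartition.disjoint Px
      dy = IsSetPartition.disjoint Py

    -- If the block A of t in xs and the block A' of ys with the same maximum agree above t
    -- but t ∉ A', then A' has an element below t: otherwise A' ⊊ A, against |A'| = |A|.
    elementBelow : ∀ {k A A'} → A ∈ xs → t ∈ tl A → maxB A ≡ k
      → A' ∈ ys → maxB A' ≡ k → t ∉ tl A' → GreatestBelow (tl A') t
    elementBelow {k} {A} {A'} a t∈A maxA a' maxA' t∉A' with Any.any? (Fin._<? t) (tl A')
    ... | yes below with find below
    ...   | c , c∈ , c<t = findGreatestBelow c∈ c<t
    elementBelow {k} {A} {A'} a t∈A maxA a' maxA' t∉A' | no none =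
      ⊥-elim (ℕP.<-irrefl (sym (size-transfer dy same a a' (trans maxA (sym maxA')))) A'⊊A)
      where
      A'⊆A : tl A' ⊆ tl A
      A'⊆A {z} z∈ with FP.<-cmp z t
      ... | tri< z<t _ _ = ⊥-elim (none (lose z∈ z<t))
      ... | tri≈ _ refl _ = ⊥-elim (t∉A' z∈)
      ... | tri> _ _ t<z = inBlock⇒∈ dx a maxA (down z t<z k (inBlock A' a' z∈ maxA'))
      A'⊊A : length (tl A') ℕ.< length (tl A)
      A'⊊A = distinct-⊊⇒length-< Fin._≟_ (sorted⇒distinct (block-sorted Py a')) A'⊆A t∈A t∉A'

    -- If t is in the block of xs with maximum m but not in that of ys, the successor a of t
    -- in xs lies in the block of ys with maximum m, which skips t; its edge over t ends in a.
    disagreement : ∀ {m} → InBlock xs t m → ¬ InBlock ys t m → Disagreement xs ys t m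
    disagreement {m} (inBlock Bx bx t∈Bx maxBx) t∉ = record
      { next = a ; start = GreatestBelow.elem p ; t<next = above ; start<t = GreatestBelow.below p
      ; next-in = inBlock Bx bx elem∈ maxBx ; edge-x = edgeToNext bx t∈Bx s
      ; edge-y = subst (EdgeIn ys (GreatestBelow.elem p)) s'≡a (edgeOver by t∉By p s') }
      where
      t<max : t <ᶠ maxB Bx
      t<max = FP.≤∧≢⇒< (≤max Bx (block-sorted Px bx) t∈Bx) t≢max
        where
        t≢max : t ≢ maxB Bx
        t≢max t≡max with isMax-transfer same (Bx , bx , refl)
        ... | D , d , maxD = t∉ (inBlock D d (subst (_∈ tl D) (trans maxD (sym t≡max)) (max∈ D))
                                        (trans maxD maxBx))
      s : LeastAbove (tl Bx) t
      s = findLeastAbove (max∈ Bx) t<max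
      open LeastAbove s renaming (elem to a)
      open InBlock (up a above m (inBlock Bx bx elem∈ maxBx))
        renaming (block to By; block∈ to by; member to a∈By; max≡ to maxBy)
      t∉By : t ∉ tl By
      t∉By t∈By = t∉ (inBlock By by t∈By maxBy)
      p : GreatestBelow (tl By) t
      p = elementBelow bx t∈Bx maxBx by maxBy t∉By
      s' : LeastAbove (tl By) t
      s' = findLeastAbove a∈By above
      s'≡a : LeastAbove.elem s' ≡ a
      s'≡a = FP.≤-antisym (LeastAbove.least s' a a∈By above)
        (least _ (inBlock⇒∈ dx bx maxBx (down _ (LeastAbove.above s') m
          (inBlock By by (LeastAbove.elem∈ s') maxBy))) (LeastAbove.above s'))

  -- Disagreements in both directions at the same t, with different successors, give a
  -- crossing in one partition and a nesting in the other.
  clash< : ∀ {xs ys t m m'} → SameKind xs ys → (X : Disagreement xs ys t m) (Y : Disagreement ys xs t m')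
    → Disagreement.next X <ᶠ Disagreement.next Y → ⊥
  clash< (inj₁ (_ , ncy)) X Y a<b =
    ncy _ _ _ _ (Disagreement.edge-y X) (Disagreement.edge-x Y)
      (Disagreement.start<t X , Disagreement.t<next X , a<b)
  clash< (inj₂ (nnx , _)) X Y a<b =
    nnx _ _ _ _ (Disagreement.edge-y Y) (Disagreement.edge-x X)
      (Disagreement.start<t Y , Disagreement.t<next X , a<b)

  clash : ∀ {xs ys t m m'} → SameKind xs ys → (X : Disagreement xs ys t m) (Y : Disagreement ys xs t m')
    → Disagreement.next X ≢ Disagreement.next Y → ⊥
  clash kind X Y a≢b with FP.<-cmp (Disagreement.next X) (Disagreement.next Y)
  ... | tri< a<b _ _ = clash< kind X Y a<b
  ... | tri≈ _ a≡b _ = a≢b a≡b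
  ... | tri> _ _ b<a = clash< (sameKind-sym kind) Y X b<a

  agreeAt : (xs ys : List (Block n)) (Px : IsSetPartition n xs) (Py : IsSetPartition n ys)
    → Matches xs ys → SameKind xs ys → (t : Fin n)
    → AgreeAbove xs ys t → AgreeAbove ys xs t → AgreeAt xs ys t
  agreeAt xs ys Px Py same kind t up down m t∈X with find (IsSetPartition.covering Py t)
  ... | Cy , cy , t∈Cy with maxB Cy Fin.≟ m
  ... | yes max≡m = inBlock Cy cy t∈Cy max≡m
  ... | no max≢m = ⊥-elim (clash kind X Y a≢b)
    where
    dx = IsSetPartition.disjoint Px
    dy = IsSetPartition.disjoint Py
    t∈Y : InBlock ys t (maxB Cy)
    t∈Y = inBlock Cy cy t∈Cy refl
    X = Disagreeing.disagreement xs ys Px Py same t up down t∈X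
          (λ t∈Y' → max≢m (inBlock-functional dy t∈Y t∈Y'))
    Y = Disagreeing.disagreement ys xs Py Px (matches-sym same) t down up t∈Y
          (λ t∈X' → max≢m (inBlock-functional dx t∈X' t∈X))
    a≢b : Disagreement.next X ≢ Disagreement.next Y
    a≢b a≡b = max≢m (inBlock-functional dx
      (down _ (Disagreement.t<next Y) _ (Disagreement.next-in Y))
      (subst (λ z → InBlock xs z m) a≡b (Disagreement.next-in X)))

  agreeEverywhere : (xs ys : List (Block n)) (Px : IsSetPartition n xs) (Py : IsSetPartition n ys)
    → Matches xs ys → SameKind xs ys → ∀ z → AgreeAt xs ys z
  agreeEverywhere xs ys Px Py same kind z = proj₁ (go z (>-wellFounded z))
    where
    go : ∀ t → Acc (λ u v → v <ᶠ u) t → AgreeAt xs ys t × AgreeAt ys xs t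
    go t (acc rec) =
      agreeAt xs ys Px Py same kind t up down ,
      agreeAt ys xs Py Px (matches-sym same) (sameKind-sym kind) t down up
      where
      up : AgreeAbove xs ys t
      up u t<u = proj₁ (go u (rec t<u))
      down : AgreeAbove ys xs t
      down u t<u = proj₂ (go u (rec t<u))

  uniqueness : (xs ys : List (Block n)) → IsSetPartition n xs → IsSetPartition n ys
    → Matches xs ys → SameKind xs ys → xs ≡ ys
  uniqueness xs ys Px Py same kind = go same (λ b → b) (λ b → b)
    where
    dx = IsSetPartition.disjoint Px
    dy = IsSetPartition.disjoint Py
    agree : ∀ z k → InBlock xs z k → InBlock ys z k
    agree = agreeEverywhere xs ys Px Py same kind
    agree⁻ : ∀ z k → InBlock ys z k → InBlock xs z k
    agree⁻ = agreeEverywhere ys xs Py Px (matches-sym same) (sameKind-sym kind)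
    -- corresponding blocks have the same maximum, hence the same elements
    go : ∀ {us vs} → Matches us vs → (∀ {B} → B ∈ us → B ∈ xs) → (∀ {B} → B ∈ vs → B ∈ ys) → us ≡ vs
    go [] _ _ = refl
    go {B ∷ us} {B' ∷ vs} ((max≡ , _) ∷ rest) us⊆ vs⊆ =
      cong₂ _∷_ (tl-injective (sorted-≡ (block-sorted Px b) (block-sorted Py b') B⊆B' B'⊆B))
        (go rest (λ u → us⊆ (there u)) (λ v → vs⊆ (there v)))
      where
      b = us⊆ (here refl)
      b' = vs⊆ (here refl)
      B⊆B' : tl B ⊆ tl B'
      B⊆B' {z} z∈ = inBlock⇒∈ dy b' (sym max≡) (agree z (maxB B) (inBlock B b z∈ refl))
      B'⊆B : tl B' ⊆ tl B
      B'⊆B {z} z∈ = inBlock⇒∈ dx b max≡ (agree⁻ z (maxB B') (inBlock B' b' z∈ refl))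

-- Existence: every profile of a partition is the profile of a noncrossing partition.
--
-- The greedy construction treats the profile entries (m , s) by increasing maximum m, taking
-- from the pool U of unused elements the block consisting of m and the s - 1 largest elements
-- of U below m.  All elements of U strictly between two elements of such a block belong to
-- it, which is what makes the result noncrossing.

module _ {n : ℕ} where
  Entry : Set
  Entry = Fin n × ℕ

  profileOf : Block n → Entry
  profileOf B = maxB B , sizeB B

  Describes : Entry → Block n → Set
  Describes e B = proj₁ e ≡ maxB B × proj₂ e ≡ sizeB B

  ∈-take⇒∈ : ∀ {z : Fin n} k xs → z ∈ take k xs → z ∈ xs
  ∈-take⇒∈ k xs p = subst (_ ∈_) (LP.take++drop≡id k xs) (∈-++⁺ˡ p)

  ∈-drop⇒∈ : ∀ {z : Fin n} k xs → z ∈ drop k xs → z ∈ xs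
  ∈-drop⇒∈ k xs p = subst (_ ∈_) (LP.take++drop≡id k xs) (∈-++⁺ʳ (take k xs) p)

  ∈-take⊎drop : ∀ {z : Fin n} k xs → z ∈ xs → z ∈ take k xs ⊎ z ∈ drop k xs
  ∈-take⊎drop k xs p = ∈-++⁻ (take k xs) (subst (_ ∈_) (sym (LP.take++drop≡id k xs)) p)

  sorted-take<drop : ∀ {xs : List (Fin n)} {p q} k → Sorted xs → p ∈ take k xs → q ∈ drop k xs → p <ᶠ q
  sorted-take<drop {xs} k s = sorted-++ (subst Sorted (sym (LP.take++drop≡id k xs)) s)

  tl-∷ʳ : ∀ (xs : List (Fin n)) m → tl (xs L⁺.∷ʳ m) ≡ xs ++ L.[ m ]
  tl-∷ʳ [] m = refl
  tl-∷ʳ (x ∷ xs) m = refl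

  max-∷ʳ : ∀ (xs : List (Fin n)) m → maxB (xs L⁺.∷ʳ m) ≡ m
  max-∷ʳ xs m with block-init (xs L⁺.∷ʳ m)
  ... | ys , eq = LP.∷ʳ-injectiveʳ ys xs (trans (sym eq) (tl-∷ʳ xs m))

  countUpTo : List (Fin n) → Fin n → ℕ
  countUpTo U x = length (filter (Fin._≤? x) U)

  -- The entries D can be served from the pool U after a elements have been handed out:
  -- maxima are available and increasing, every prefix of sizes (offset by a) fits below its
  -- maximum, and the sizes exhaust U.
  Feasible : List (Fin n) → ℕ → List Entry → Set
  Feasible U a [] = a ≡ length U
  Feasible U a ((m , s) ∷ D) = m ∈ U × 1 ℕ.≤ s × a + s ℕ.≤ countUpTo U m
    × All (λ e → m <ᶠ proj₁ e) D × Feasible U (a + s) D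

  below above : List (Fin n) → Fin n → List (Fin n)
  below U m = filter (Fin._<? m) U
  above U m = filter (m Fin.<?_) U

  keep : List (Fin n) → Fin n → ℕ → ℕ
  keep U m s = length (below U m) ∸ (s ∸ 1)

  chosen : List (Fin n) → Fin n → ℕ → List (Fin n)
  chosen U m s = drop (keep U m s) (below U m)

  greedyBlock : List (Fin n) → Fin n → ℕ → Block n
  greedyBlock U m s = chosen U m s L⁺.∷ʳ m

  leftover : List (Fin n) → Fin n → ℕ → List (Fin n)
  leftover U m s = take (keep U m s) (below U m) ++ above U m

  greedy : List (Fin n) → List Entry → List (Block n)
  greedy U [] = []
  greedy U ((m , s) ∷ D) = greedyBlock U m s ∷ greedy (leftover U m s) D

  module GreedyStep (U : List (Fin n)) (sU : Sorted U) (m : Fin n) (m∈ : m ∈ U) (s : ℕ) where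
    L = below U m
    k = keep U m s
    I = greedyBlock U m s
    R = leftover U m s

    sL : Sorted L
    sL = APP.filter⁺ _ sU

    I-elem : ∀ {z} → z ∈ tl I → z ∈ chosen U m s ⊎ z ≡ m
    I-elem {z} p with ∈-++⁻ (chosen U m s) (subst (z ∈_) (tl-∷ʳ (chosen U m s) m) p)
    ... | inj₁ q = inj₁ q
    ... | inj₂ (here q) = inj₂ q

    chosen⊆I : ∀ {z} → z ∈ chosen U m s → z ∈ tl I
    chosen⊆I p = subst (_ ∈_) (sym (tl-∷ʳ (chosen U m s) m)) (∈-++⁺ˡ p)

    m∈I : m ∈ tl I
    m∈I = subst (_ ∈_) (sym (tl-∷ʳ (chosen U m s) m)) (∈-++⁺ʳ (chosen U m s) (here refl))

    ∈below : ∀ {z} → z ∈ L → z ∈ U × z <ᶠ m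
    ∈below p = ∈-filter⁻ (Fin._<? m) {xs = U} p

    ∈above : ∀ {z} → z ∈ above U m → z ∈ U × m <ᶠ z
    ∈above p = ∈-filter⁻ (m Fin.<?_) {xs = U} p

    I≤m : ∀ {z} → z ∈ tl I → z ≤ᶠ m
    I≤m p with I-elem p
    ... | inj₁ q = ℕP.<⇒≤ (proj₂ (∈below (∈-drop⇒∈ k L q)))
    ... | inj₂ refl = ℕP.≤-refl

    split : ∀ {z} → z ∈ U → z ∈ tl I ⊎ z ∈ R
    split {z} p with FP.<-cmp z m
    ... | tri≈ _ refl _ = inj₁ m∈I
    ... | tri> _ _ m<z = inj₂ (∈-++⁺ʳ (take k L) (∈-filter⁺ (m Fin.<?_) p m<z))
    ... | tri< z<m _ _ with ∈-take⊎drop k L (∈-filter⁺ (Fin._<? m) p z<m)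
    ... | inj₁ q = inj₂ (∈-++⁺ˡ q)
    ... | inj₂ q = inj₁ (chosen⊆I q)

    I⊆U : tl I ⊆ U
    I⊆U p with I-elem p
    ... | inj₁ q = proj₁ (∈below (∈-drop⇒∈ k L q))
    ... | inj₂ refl = m∈

    R⊆U : R ⊆ U
    R⊆U p with ∈-++⁻ (take k L) p
    ... | inj₁ q = proj₁ (∈below (∈-take⇒∈ k L q))
    ... | inj₂ q = proj₁ (∈above q)

    above⊆R : ∀ {z} → z ∈ U → m <ᶠ z → z ∈ R
    above⊆R p m<z = ∈-++⁺ʳ (take k L) (∈-filter⁺ (m Fin.<?_) p m<z)

    I#R : ∀ {z} → z ∈ tl I → z ∉ R
    I#R p q with I-elem p | ∈-++⁻ (take k L) q
    ... | inj₁ a | inj₁ b = FP.<-irrefl refl (sorted-take<drop k sL b a)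
    ... | inj₁ a | inj₂ b = FP.<-asym (proj₂ (∈below (∈-drop⇒∈ k L a))) (proj₂ (∈above b))
    ... | inj₂ refl | inj₁ b = FP.<-irrefl refl (proj₂ (∈below (∈-take⇒∈ k L b)))
    ... | inj₂ refl | inj₂ b = FP.<-irrefl refl (proj₂ (∈above b))

    sI : Sorted (tl I)
    sI = subst Sorted (sym (tl-∷ʳ (chosen U m s) m))
      (APP.++⁺ (APP.drop⁺ k sL) ([] ∷ [])
        (All.tabulate (λ z∈ → proj₂ (∈below (∈-drop⇒∈ k L z∈)) ∷ [])))

    sR : Sorted R
    sR = APP.++⁺ (APP.take⁺ k sL) (APP.filter⁺ _ sU)
      (All.tabulate (λ z∈ → All.tabulate (λ w∈ →
        FP.<-trans (proj₂ (∈below (∈-take⇒∈ k L z∈))) (proj₂ (∈above w∈)))))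

    interval : ∀ {u x y} → u ∈ U → x ∈ tl I → y ∈ tl I → x <ᶠ u → u <ᶠ y → u ∈ tl I
    interval {u} {x} u∈ x∈ y∈ x<u u<y with split u∈
    ... | inj₁ q = q
    ... | inj₂ q with ∈-++⁻ (take k L) q
    ... | inj₂ g = ⊥-elim (ℕP.<⇒≱ (proj₂ (∈above g)) (ℕP.<⇒≤ (ℕP.<-≤-trans u<y (I≤m y∈))))
    ... | inj₁ t with I-elem x∈
    ... | inj₁ xd = ⊥-elim (FP.<-asym x<u (sorted-take<drop k sL t xd))
    ... | inj₂ refl = ⊥-elim (FP.<-asym x<u (proj₂ (∈below (∈-take⇒∈ k L t))))

    size-I : 1 ℕ.≤ s → s ℕ.≤ suc (length L) → length (tl I) ≡ s
    size-I 1≤s s≤ = begin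
        length (tl I)                      ≡⟨ cong length (tl-∷ʳ (chosen U m s) m) ⟩
        length (chosen U m s ++ L.[ m ])   ≡⟨ LP.length-++ (chosen U m s) ⟩
        length (chosen U m s) + 1          ≡⟨ cong (_+ 1) (LP.length-drop k L) ⟩
        (length L ∸ k) + 1                 ≡⟨ cong (_+ 1) (ℕP.m∸[m∸n]≡n (ℕP.∸-monoˡ-≤ 1 s≤)) ⟩
        (s ∸ 1) + 1                        ≡⟨ ℕP.m∸n+n≡m 1≤s ⟩
        s                                  ∎
      where open ≡-Reasoning

    count-m : countUpTo U m ℕ.≤ suc (length L)
    count-m = distinct-⊆⇒length-≤ Fin._≟_ (APP.filter⁺ _ (sorted⇒distinct sU)) upTo⊆
      where
      upTo⊆ : filter (Fin._≤? m) U ⊆ (m ∷ L)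
      upTo⊆ {z} p with ∈-filter⁻ (Fin._≤? m) {xs = U} p
      ... | z∈ , z≤ with FP.<-cmp z m
      ... | tri≈ _ refl _ = here refl
      ... | tri< z<m _ _ = there (∈-filter⁺ (Fin._<? m) z∈ z<m)
      ... | tri> _ _ m<z = ⊥-elim (ℕP.<⇒≱ m<z z≤)

    count-split : 1 ℕ.≤ s → s ℕ.≤ suc (length L) → ∀ x → countUpTo U x ℕ.≤ s + countUpTo R x
    count-split 1≤s s≤ x = subst (λ w → countUpTo U x ℕ.≤ w + countUpTo R x) (size-I 1≤s s≤)
      (subst (countUpTo U x ℕ.≤_) (LP.length-++ (tl I))
        (distinct-⊆⇒length-≤ Fin._≟_ (APP.filter⁺ _ (sorted⇒distinct sU)) upTo⊆))
      where
      upTo⊆ : filter (Fin._≤? x) U ⊆ (tl I ++ filter (Fin._≤? x) R)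
      upTo⊆ p with ∈-filter⁻ (Fin._≤? x) {xs = U} p
      ... | z∈ , z≤ with split z∈
      ... | inj₁ q = ∈-++⁺ˡ q
      ... | inj₂ q = ∈-++⁺ʳ (tl I) (∈-filter⁺ (Fin._≤? x) q z≤)

    length-split : 1 ℕ.≤ s → s ℕ.≤ suc (length L) → length U ≡ s + length R
    length-split 1≤s s≤ = trans (ℕP.≤-antisym U≤ U≥) (cong (_+ length R) (size-I 1≤s s≤))
      where
      U≤ : length U ℕ.≤ length (tl I) + length R
      U≤ = subst (length U ℕ.≤_) (LP.length-++ (tl I))
        (distinct-⊆⇒length-≤ Fin._≟_ (sorted⇒distinct sU) (λ p → [ ∈-++⁺ˡ , ∈-++⁺ʳ (tl I) ]′ (split p)))
      U≥ : length (tl I) + length R ℕ.≤ length U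
      U≥ = subst (ℕ._≤ length U) (LP.length-++ (tl I))
        (distinct-⊆⇒length-≤ Fin._≟_
          (APP.++⁺ (sorted⇒distinct sI) (sorted⇒distinct sR)
            (All.tabulate (λ z∈ → All.tabulate (λ w∈ z≡w → I#R z∈ (subst (_∈ R) (sym z≡w) w∈)))))
          (λ p → [ I⊆U , R⊆U ]′ (∈-++⁻ (tl I) p)))

  feasible-leftover : ∀ {U U' : List (Fin n)} {a s : ℕ} {m : Fin n} D → Feasible U (a + s) D
    → All (λ e → m <ᶠ proj₁ e) D → (∀ {x} → x ∈ U → m <ᶠ x → x ∈ U')
    → (∀ x → countUpTo U x ℕ.≤ s + countUpTo U' x) → length U ≡ s + length U' → Feasible U' a D
  feasible-leftover {U} {U'} {a} {s} [] total _ _ _ len =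
    ℕP.+-cancelʳ-≡ s a (length U') (trans total (trans len (ℕP.+-comm s _)))
  feasible-leftover {U} {U'} {a} {s} ((m₂ , s₂) ∷ D) (m₂∈ , 1≤s₂ , fits , incr , rest) (m<m₂ ∷ m<D)
    keeps counts len =
    keeps m₂∈ m<m₂ , 1≤s₂ , fits' , incr ,
    feasible-leftover D (subst (λ w → Feasible U w D) swap rest) m<D keeps counts len
    where
    swap : a + s + s₂ ≡ a + s₂ + s
    swap = trans (ℕP.+-assoc a s s₂) (trans (cong (a +_) (ℕP.+-comm s s₂)) (sym (ℕP.+-assoc a s₂ s)))
    fits' : a + s₂ ℕ.≤ countUpTo U' m₂
    fits' = ℕP.+-cancelˡ-≤ s _ _
      (subst (ℕ._≤ s + countUpTo U' m₂) (trans swap (ℕP.+-comm (a + s₂) s))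
        (ℕP.≤-trans fits (counts m₂)))

  record GreedyOK (U : List (Fin n)) (D : List Entry) (cs : List (Block n)) : Set where
    field
      describes  : Pointwise Describes D cs
      increasing : All (λ B → Sorted (tl B)) cs
      ordered    : AllPairs (λ A B → maxB A <ᶠ maxB B) cs
      within     : All (λ B → tl B ⊆ U) cs
      disjoint   : AllPairs Disjoint cs
      covering   : ∀ {z} → z ∈ U → Any (λ B → z ∈ tl B) cs
      noncrossing : NoncrossingIn cs

  maxima-above : ∀ {D cs} {m : Fin n} → Pointwise Describes D cs → All (λ e → m <ᶠ proj₁ e) D
    → All (λ B → m <ᶠ maxB B) cs
  maxima-above [] [] = []
  maxima-above ((max≡ , _) ∷ ds) (m< ∷ ms) = subst (_ <ᶠ_) max≡ m< ∷ maxima-above ds ms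

  noncrossing-∷ : ∀ (I : Block n) cs (U W : List (Fin n)) → All (λ B → tl B ⊆ W) cs → W ⊆ U
    → (∀ {z} → z ∈ tl I → z ∉ W)
    → (∀ {u x y} → u ∈ U → x ∈ tl I → y ∈ tl I → x <ᶠ u → u <ᶠ y → u ∈ tl I)
    → NoncrossingIn cs → NoncrossingIn (I ∷ cs)
  noncrossing-∷ I cs U W inW W⊆U I#W intv nc a b c d
    (_ , here (_ , _ , gap)) (_ , here (c∈ , _ , _)) (a<c , c<b , _) = gap c c∈ (a<c , c<b)
  noncrossing-∷ I cs U W inW W⊆U I#W intv nc a b c d
    (_ , here (a∈ , b∈ , _)) (_ , there q) (a<c , c<b , _) with find q
  ... | C , C∈ , c∈ , _ = I#W (intv (W⊆U c∈W) a∈ b∈ a<c c<b) c∈W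
    where c∈W = All.lookup inW C∈ c∈
  noncrossing-∷ I cs U W inW W⊆U I#W intv nc a b c d
    (_ , there p) (_ , here (c∈ , d∈ , _)) (_ , c<b , b<d) with find p
  ... | B , B∈ , _ , b∈ , _ = I#W (intv (W⊆U b∈W) c∈ d∈ c<b b<d) b∈W
    where b∈W = All.lookup inW B∈ b∈
  noncrossing-∷ I cs U W inW W⊆U I#W intv nc a b c d (a<b , there p) (c<d , there q) h =
    nc a b c d (a<b , p) (c<d , q) h

  greedy-ok : ∀ D U → Sorted U → Feasible U 0 D → GreedyOK U D (greedy U D)
  greedy-ok [] [] sU _ = record
    { describes = [] ; increasing = [] ; ordered = [] ; within = [] ; disjoint = []
    ; covering = λ () ; noncrossing = λ { _ _ _ _ (_ , ()) } }
  greedy-ok [] (_ ∷ _) sU ()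
  greedy-ok ((m , s) ∷ D) U sU (m∈ , 1≤s , fits , incr , rest) = record
    { describes = (sym (max-∷ʳ (chosen U m s) m) , sym (trans (size≡length I) (size-I 1≤s s≤))) ∷ describes
    ; increasing = sI ∷ increasing
    ; ordered = I<rest ∷ ordered
    ; within = I⊆U ∷ All.map (λ B⊆R {z} p → R⊆U (B⊆R p)) within
    ; disjoint = All.tabulate (λ B∈ z z∈I z∈B → I#R z∈I (All.lookup within B∈ z∈B)) ∷ disjoint
    ; covering = λ z∈ → [ here , (λ q → there (covering q)) ]′ (split z∈)
    ; noncrossing = noncrossing-∷ I (greedy R D) U R within R⊆U I#R interval noncrossing
    }
    where
    open GreedyStep U sU m m∈ s
    s≤ : s ℕ.≤ suc (length L)
    s≤ = ℕP.≤-trans fits count-m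
    open GreedyOK (greedy-ok D R sR
      (feasible-leftover D rest incr above⊆R (count-split 1≤s s≤) (length-split 1≤s s≤)))
    I<rest : All (λ B → maxB I <ᶠ maxB B) (greedy R D)
    I<rest = subst (λ w → All (λ B → w <ᶠ maxB B) (greedy R D)) (sym (max-∷ʳ (chosen U m s) m))
      (maxima-above describes incr)

module _ {n : ℕ} where
  elements : List (Block n) → List (Fin n)
  elements [] = []
  elements (B ∷ bs) = tl B ++ elements bs

  elements-++ : ∀ xs ys → elements (xs ++ ys) ≡ elements xs ++ elements ys
  elements-++ [] ys = refl
  elements-++ (B ∷ xs) ys =
    trans (cong (tl B ++_) (elements-++ xs ys)) (sym (LP.++-assoc (tl B) (elements xs) (elements ys)))

  ∈-elements⁻ : ∀ {z} bs → z ∈ elements bs → Σ (Block n) λ B → B ∈ bs × z ∈ tl B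
  ∈-elements⁻ (B ∷ bs) p with ∈-++⁻ (tl B) p
  ... | inj₁ q = B , here refl , q
  ... | inj₂ q with ∈-elements⁻ bs q
  ... | C , c , r = C , there c , r

  ∈-elements⁺ : ∀ {z B} bs → B ∈ bs → z ∈ tl B → z ∈ elements bs
  ∈-elements⁺ (B ∷ bs) (here refl) q = ∈-++⁺ˡ q
  ∈-elements⁺ (B ∷ bs) (there b) q = ∈-++⁺ʳ (tl B) (∈-elements⁺ bs b q)

  elements-distinct : ∀ bs → All (λ B → Sorted (tl B)) bs → AllPairs Disjoint bs → Distinct (elements bs)
  elements-distinct [] _ _ = []
  elements-distinct (B ∷ bs) (sB ∷ s) (B# ∷ d) =
    APP.++⁺ (sorted⇒distinct sB) (elements-distinct bs s d)
      (All.tabulate (λ x∈ → All.tabulate (λ w∈ x≡w →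
        let (C , c , w∈C) = ∈-elements⁻ bs w∈ in All.lookup B# c _ x∈ (subst (_∈ tl C) (sym x≡w) w∈C))))

  distinct-++ˡ : ∀ (xs : List (Fin n)) {ys} → Distinct (xs ++ ys) → Distinct xs
  distinct-++ˡ [] _ = []
  distinct-++ˡ (x ∷ xs) (x# ∷ d) = All.tabulate (λ y∈ → All.lookup x# (∈-++⁺ˡ y∈)) ∷ distinct-++ˡ xs d

  allPairs-before : ∀ {R : Block n → Block n → Set} pre {B post C}
    → AllPairs R (pre ++ B ∷ post) → C ∈ pre → R C B
  allPairs-before (X ∷ pre) (X# ∷ _) (here refl) = All.lookup X# (∈-++⁺ʳ pre (here refl))
  allPairs-before (X ∷ pre) (_ ∷ a) (there c) = allPairs-before pre a c

  allPairs-after : ∀ {R : Block n → Block n → Set} pre {B post} → AllPairs R (pre ++ B ∷ post) → All (R B) post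
  allPairs-after [] (B# ∷ _) = B#
  allPairs-after (X ∷ pre) (_ ∷ a) = allPairs-after pre a

  allFin-sorted : Sorted (allFin n)
  allFin-sorted = APP.tabulate⁺-< (λ i<j → i<j)

  module ProfileFeasible (π : List (Block n)) (P : IsSetPartition n π) where
    sorted-blocks : All (λ B → Sorted (tl B)) π
    sorted-blocks = All.map (LinkedP.Linked⇒AllPairs FP.<-trans) (IsSetPartition.increasing P)

    distinct : Distinct (elements π)
    distinct = elements-distinct π sorted-blocks (IsSetPartition.disjoint P)

    1≤size : ∀ (B : Block n) → 1 ℕ.≤ sizeB B
    1≤size (_ ∷ _) = s≤s z≤n

    -- Splitting π = pre ++ post, the entries of post are feasible once the elements of pre
    -- are handed out: the blocks up to B contain only elements ≤ max B, and π covers [n].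
    suffix : ∀ pre post → pre ++ post ≡ π → Feasible (allFin n) (length (elements pre)) (map profileOf post)
    suffix pre [] eq = ℕP.≤-antisym
      (distinct-⊆⇒length-≤ Fin._≟_ (subst (λ w → Distinct (elements w)) (sym pre≡π) distinct)
        (λ {z} _ → ∈-allFin z))
      (distinct-⊆⇒length-≤ Fin._≟_ (sorted⇒distinct allFin-sorted) (λ {z} _ →
        subst (λ w → z ∈ elements w) (sym pre≡π)
          (let (C , c , z∈C) = find (IsSetPartition.covering P z) in ∈-elements⁺ π c z∈C)))
      where
      pre≡π : pre ≡ π
      pre≡π = trans (sym (LP.++-identityʳ pre)) eq
    suffix pre (B ∷ post) eq =
      ∈-allFin (maxB B) , 1≤size B ,
      subst (ℕ._≤ countUpTo (allFin n) (maxB B)) size≡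
        (distinct-⊆⇒length-≤ Fin._≟_ (distinct-++ˡ (elements pre⁺) (subst Distinct split≡ distinct)) upTo) ,
      AllP.map⁺ (allPairs-after pre ordered) ,
      subst (λ w → Feasible (allFin n) w (map profileOf post)) size≡
        (suffix pre⁺ post (trans (LP.++-assoc pre L.[ B ] post) eq))
      where
      pre⁺ = pre ++ L.[ B ]
      ordered : AllPairs (λ A B → maxB A <ᶠ maxB B) (pre ++ B ∷ post)
      ordered = subst (AllPairs _) (sym eq) (LinkedP.Linked⇒AllPairs FP.<-trans (IsSetPartition.ordered P))
      split≡ : elements π ≡ elements pre⁺ ++ elements post
      split≡ = trans (cong elements (sym (trans (LP.++-assoc pre L.[ B ] post) eq))) (elements-++ pre⁺ post)
      size≡ : length (elements pre⁺) ≡ length (elements pre) + sizeB B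
      size≡ = trans (cong length (elements-++ pre L.[ B ]))
        (trans (LP.length-++ (elements pre))
          (cong (length (elements pre) +_) (trans (cong length (LP.++-identityʳ (tl B))) (sym (size≡length B)))))
      sortedIn : ∀ {C} → C ∈ pre ++ B ∷ post → Sorted (tl C)
      sortedIn c = All.lookup sorted-blocks (subst (_ ∈_) eq c)
      upTo : elements pre⁺ ⊆ filter (Fin._≤? maxB B) (allFin n)
      upTo {z} p with ∈-elements⁻ pre⁺ p
      ... | C , c , z∈C with ∈-++⁻ pre c
      ... | inj₂ (here refl) = ∈-filter⁺ (Fin._≤? maxB B) (∈-allFin z) (≤max B (sortedIn (∈-++⁺ʳ pre (here refl))) z∈C)
      ... | inj₁ c' = ∈-filter⁺ (Fin._≤? maxB B) (∈-allFin z)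
        (ℕP.<⇒≤ (ℕP.≤-<-trans (≤max C (sortedIn (∈-++⁺ˡ c')) z∈C) (allPairs-before pre ordered c')))

    feasible : Feasible (allFin n) 0 (map profileOf π)
    feasible = suffix [] π refl

  describes⇒matches : ∀ (π : List (Block n)) {cs} → Pointwise Describes (map profileOf π) cs → Matches π cs
  describes⇒matches [] [] = []
  describes⇒matches (B ∷ π) (d ∷ ds) = d ∷ describes⇒matches π ds

  ncRealisation : List (Block n) → List (Block n)
  ncRealisation π = greedy (allFin n) (map profileOf π)

  module _ (π : List (Block n)) (P : IsSetPartition n π) where
    open GreedyOK (greedy-ok (map profileOf π) (allFin n) allFin-sorted (ProfileFeasible.feasible π P))

    ncRealisation-partition : IsSetPartition n (ncRealisation π)
    ncRealisation-partition = record
      { increasing = All.map LinkedP.AllPairs⇒Linked increasing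
      ; ordered = LinkedP.AllPairs⇒Linked ordered
      ; disjoint = disjoint
      ; covering = λ i → covering (∈-allFin i) }

    ncRealisation-noncrossing : NoncrossingIn (ncRealisation π)
    ncRealisation-noncrossing = noncrossing

    ncRealisation-matches : Matches π (ncRealisation π)
    ncRealisation-matches = describes⇒matches π describes

-- Nonalignment depends only on which elements are block maxima.

module _ {n : ℕ} where
  NonalignedIn : List (Block n) → Block n → Set
  NonalignedIn bs B = ∀ i j → EdgeIn bs i j → ¬ (maxB B <ᶠ i)

  edge⇒notMax : ∀ {bs i j} → IsSetPartition n bs → EdgeIn bs i j → ¬ IsMax bs i
  edge⇒notMax P (i<j , e) (D , d , maxD≡i) with find e
  ... | C , c , i∈C , j∈C , _ with block-unique (IsSetPartition.disjoint P) d c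
                                   (subst (_∈ tl D) maxD≡i (max∈ D)) i∈C
  ... | refl = ℕP.<⇒≱ i<j (subst (_ ≤ᶠ_) maxD≡i (≤max C (block-sorted P c) j∈C))

  notMax⇒edge : ∀ {bs i} → IsSetPartition n bs → ¬ IsMax bs i → ∃ λ j → EdgeIn bs i j
  notMax⇒edge {i = i} P notMax with find (IsSetPartition.covering P i)
  ... | E , e , i∈E = LeastAbove.elem s , edgeToNext e i∈E s
    where
    i<max : i <ᶠ maxB E
    i<max = FP.≤∧≢⇒< (≤max E (block-sorted P e) i∈E) (λ i≡max → notMax (E , e , sym i≡max))
    s : LeastAbove (tl E) i
    s = findLeastAbove (max∈ E) i<max

  nonaligned-transfer : ∀ {xs ys B B'} → IsSetPartition n xs → IsSetPartition n ys → Matches xs ys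
    → maxB B ≡ maxB B' → NonalignedIn xs B → NonalignedIn ys B'
  nonaligned-transfer {B' = B'} Px Py same max≡ na i j e B'<i
    with notMax⇒edge Px (λ isMax → edge⇒notMax Py e (isMax-transfer same isMax))
  ... | a , e' = na i a e' (subst (_<ᶠ i) (sym max≡) B'<i)

module _ {A B : Set} {R : A → B → Set} where
  source : ∀ {xs ys} → Pointwise R xs ys → Fin (length ys) → Fin (length xs)
  source (_ ∷ _) Fin.zero = Fin.zero
  source (_ ∷ rs) (Fin.suc q) = Fin.suc (source rs q)

  lookup-source : ∀ {xs ys} (rs : Pointwise R xs ys) q → R (L.lookup xs (source rs q)) (L.lookup ys q)
  lookup-source (r ∷ rs) Fin.zero = r
  lookup-source (r ∷ rs) (Fin.suc q) = lookup-source rs q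

module _ {A B : Set} {R : A → B → Set} {C : Set} where
  transport : ∀ {xs ys} → Pointwise R xs ys → Vec C (length xs) → Vec C (length ys)
  transport [] [] = []
  transport (_ ∷ rs) (v ∷ vs) = v ∷ transport rs vs

  toList-transport : ∀ {xs ys} (rs : Pointwise R xs ys) (v : Vec C (length xs))
    → V.toList (transport rs v) ≡ V.toList v
  toList-transport [] [] = refl
  toList-transport (_ ∷ rs) (v ∷ vs) = cong (v ∷_) (toList-transport rs vs)

  lookup-transport : ∀ {xs ys} (rs : Pointwise R xs ys) (v : Vec C (length xs)) q
    → V.lookup (transport rs v) q ≡ V.lookup v (source rs q)
  lookup-transport (_ ∷ rs) (v ∷ vs) Fin.zero = refl
  lookup-transport (_ ∷ rs) (v ∷ vs) (Fin.suc q) = lookup-transport rs vs q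

module _ {n : ℕ} where
  marks-nonaligned : ∀ (xs ys : List (Block n)) → IsSetPartition n xs → IsSetPartition n ys
    → (same : Matches xs ys) (m : Vec Bool (length xs))
    → (∀ p → V.lookup m p ≡ true → NonalignedIn xs (L.lookup xs p))
    → ∀ q → V.lookup (transport same m) q ≡ true → NonalignedIn ys (L.lookup ys q)
  marks-nonaligned xs ys Px Py same m na q marked =
    nonaligned-transfer {B = L.lookup xs (source same q)} {B' = L.lookup ys q} Px Py same (proj₁ (lookup-source same q))
      (na (source same q) (trans (sym (lookup-transport same m q)) marked))

  selected-matches : ∀ {xs ys : List (Block n)} (same : Matches xs ys) (m : Vec Bool (length xs))
    → Matches (selectMarked xs m) (selectMarked ys (transport same m))
  selected-matches [] [] = []
  selected-matches (r ∷ same) (true ∷ m) = r ∷ selected-matches same m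
  selected-matches (r ∷ same) (false ∷ m) = selected-matches same m

  type-matches : ∀ {xs ys : List (Block n)} → Matches xs ys → L.map sizeB xs ≡ L.map sizeB ys
  type-matches same = Pointwise-≡⇒≡ (Pointwise.map⁺ sizeB sizeB (Pointwise.map proj₂ same))

module _ {n : ℕ} where
  blocks-≟ : DecidableEquality (List (Block n))
  blocks-≟ = LP.≡-dec (λ A B → map′ tl-injective (cong tl) (LP.≡-dec Fin._≟_ (tl A) (tl B)))

  matches? : (xs ys : List (Block n)) → Dec (Matches xs ys)
  matches? = PWP.decidable (λ A B → (maxB A Fin.≟ maxB B) ×-dec (sizeB A ℕ.≟ sizeB B))

  -- uniqueness for block lists whose properties are only known irrelevantly
  determinedByProfile : (xs ys : List (Block n)) → .(IsSetPartition n xs) → .(IsSetPartition n ys)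
    → Matches xs ys → .(SameKind xs ys) → xs ≡ ys
  determinedByProfile xs ys Px Py same kind =
    recompute (blocks-≟ xs ys) (uniqueness xs ys Px Py same kind)

  ncna-≡ : (x y : NCNA n) → blocks (NCNA.part x) ≡ blocks (NCNA.part y)
    → toList (NCNA.marks x) ≡ toList (NCNA.marks y) → x ≡ y
  ncna-≡ (mkNCNA (mkPartition bs _) _ m _) (mkNCNA (mkPartition .bs _) _ m' _) refl marks≡
    with refl ← trans (sym (VP.cast-is-id refl m)) (VP.toList-injective refl m m' marks≡) = refl

  nnna-≡ : (x y : NNNA n) → blocks (NNNA.part x) ≡ blocks (NNNA.part y)
    → toList (NNNA.marks x) ≡ toList (NNNA.marks y) → x ≡ y
  nnna-≡ (mkNNNA (mkPartition bs _) _ m _) (mkNNNA (mkPartition .bs _) _ m' _) refl marks≡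
    with refl ← trans (sym (VP.cast-is-id refl m)) (VP.toList-injective refl m m' marks≡) = refl

  transferMarks : (x : NCNA n) (τ : NN n) → Matches (blocks (NCNA.part x)) (blocks (NN.part τ)) → NNNA n
  transferMarks (mkNCNA (mkPartition bs P) _ m na) (mkNN (mkPartition cs Q) nn) same =
    mkNNNA (mkPartition cs Q) nn (transport same m) (marks-nonaligned bs cs P Q same m na)

  transferMarks-part : ∀ x τ same → NNNA.part (transferMarks x τ same) ≡ NN.part τ
  transferMarks-part (mkNCNA _ _ _ _) (mkNN _ _) same = refl

  transferMarks-marks : ∀ x τ same → toList (NNNA.marks (transferMarks x τ same)) ≡ toList (NCNA.marks x)
  transferMarks-marks (mkNCNA _ _ m _) (mkNN _ _) same = toList-transport same m

  transferMarks-type : ∀ x τ same → type (NCNA.part x) ↭ type (NNNA.part (transferMarks x τ same))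
  transferMarks-type (mkNCNA _ _ _ _) (mkNN _ _) same = ↭-reflexive (type-matches same)

  transferMarks-selected : ∀ x τ same → Matches (XofNC x) (XofNN (transferMarks x τ same))
  transferMarks-selected (mkNCNA _ _ m _) (mkNN _ _) same = selected-matches same m

  module Lift (ρ : NC n → NN n) (ρ-profile : ∀ σ → Matches (blocks (NC.part σ)) (blocks (NN.part (ρ σ)))) where
    ρ̄ : NCNA n → NNNA n
    ρ̄ x = transferMarks x (ρ (ncOf x)) (ρ-profile (ncOf x))

    ρ̄-part : ∀ x → NNNA.part (ρ̄ x) ≡ NN.part (ρ (ncOf x))
    ρ̄-part x = transferMarks-part x (ρ (ncOf x)) (ρ-profile (ncOf x))

    ρ̄-marks : ∀ x → toList (NNNA.marks (ρ̄ x)) ≡ toList (NCNA.marks x)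
    ρ̄-marks x = transferMarks-marks x (ρ (ncOf x)) (ρ-profile (ncOf x))

    ρ̄-type : ∀ x → type (NCNA.part x) ↭ type (NNNA.part (ρ̄ x))
    ρ̄-type x = transferMarks-type x (ρ (ncOf x)) (ρ-profile (ncOf x))

    ρ̄-selected : ∀ x → Matches (XofNC x) (XofNN (ρ̄ x))
    ρ̄-selected x = transferMarks-selected x (ρ (ncOf x)) (ρ-profile (ncOf x))

    ρ-reflects : ∀ σ σ' → NN.part (ρ σ) ≡ NN.part (ρ σ') → Matches (blocks (NC.part σ)) (blocks (NC.part σ'))
    ρ-reflects σ σ' eq = matches-trans (ρ-profile σ)
      (subst (λ τ → Matches (blocks τ) (blocks (NC.part σ'))) (sym eq) (matches-sym (ρ-profile σ')))

    -- injectivity: uniqueness of noncrossing partitions with a given profile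
    ρ̄-injective : Injective _≡_ _≡_ ρ̄
    ρ̄-injective {x@(mkNCNA (mkPartition bs P) c _ _)} {y@(mkNCNA (mkPartition bs' P') c' _ _)} ρ̄x≡ρ̄y =
      ncna-≡ x y (determinedByProfile bs bs' P P' (ρ-reflects (ncOf x) (ncOf y) parts≡) (inj₁ (c , c'))) marks≡
      where
      parts≡ : NN.part (ρ (ncOf x)) ≡ NN.part (ρ (ncOf y))
      parts≡ = trans (sym (ρ̄-part x))
        (trans (cong NNNA.part ρ̄x≡ρ̄y) (ρ̄-part y))
      marks≡ : toList (NCNA.marks x) ≡ toList (NCNA.marks y)
      marks≡ = trans (sym (ρ̄-marks x))
        (trans (cong (λ z → toList (NNNA.marks z)) ρ̄x≡ρ̄y) (ρ̄-marks y))

    -- surjectivity: realise the profile of y noncrossingly and carry the marks over; the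
    -- image under ρ has the profile of y and is nonnesting, hence equals y
    ρ̄-surjective : Surjective _≡_ _≡_ ρ̄
    ρ̄-surjective y@(mkNNNA (mkPartition bs P) nn m na) = x , λ { refl → nnna-≡ (ρ̄ x) y blocks≡ marks≡ }
      where
      cs = ncRealisation bs
      same : Matches bs cs
      same = recompute (matches? bs cs) (ncRealisation-matches bs P)
      x : NCNA n
      x = mkNCNA (mkPartition cs (ncRealisation-partition bs P)) (ncRealisation-noncrossing bs P)
        (transport same m) (marks-nonaligned bs cs P (ncRealisation-partition bs P) same m na)
      ρσ-determined : (τ : NN n) → Matches cs (blocks (NN.part τ)) → blocks (NN.part τ) ≡ bs
      ρσ-determined (mkNN (mkPartition ds Q) nnτ) same' =
        determinedByProfile ds bs Q P (matches-sym (matches-trans same same')) (inj₂ (nnτ , nn))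
      blocks≡ : blocks (NNNA.part (ρ̄ x)) ≡ bs
      blocks≡ = trans (cong blocks (ρ̄-part x)) (ρσ-determined (ρ (ncOf x)) (ρ-profile (ncOf x)))
      marks≡ : toList (NNNA.marks (ρ̄ x)) ≡ toList m
      marks≡ = trans (ρ̄-marks x) (toList-transport same m)

proposition5p3 : (n : ℕ) → 1 ≤ n →
    (ρ : NC n → NN n) →
    (∀ σ → Matches (blocks (NC.part σ)) (blocks (NN.part (ρ σ)))) →
    Σ[ ρ̄ ∈ (NCNA n → NNNA n) ]
      ((∀ x → NNNA.part (ρ̄ x) ≡ NN.part (ρ (ncOf x)))
      × (∀ x → toList (NNNA.marks (ρ̄ x)) ≡ toList (NCNA.marks x))
      × Bijective _≡_ _≡_ ρ̄
      × (∀ x → type (NCNA.part x) ↭ type (NNNA.part (ρ̄ x)))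
      × (∀ x → Matches (XofNC x) (XofNN (ρ̄ x))))
proposition5p3 n _ ρ ρ-profile =
  ρ̄ ,
  ρ̄-part ,
  ρ̄-marks ,
  (ρ̄-injective , ρ̄-surjective) ,
  ρ̄-type ,
  ρ̄-selected
  where open Lift ρ ρ-profile
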